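{- Let $t\ge 2$, let $P$ be a packing array PA$(n;t,k,v)$ with symbols $\{1,\dots,v\}$, let $w$ be a positive integer with $w\leq\frac{k-1}{t-1}$, and let $A=P^T$ (a $k\times n$ array, which is an SHF$(k;n,v,\{1,w\})$). Let $\mathcal{M}$ be the $kv\times n$ binary matrix with rows indexed by pairs $(i,x)$, $1\le i\le k$, $1\le x\le v$, columns indexed by $j=1,\dots,n$, and $\mathcal{M}_{(i,x),j}=1$ iff $A_{i,j}=x$; for each $i$, call the $v$ rows $(i,1),\dots,(i,v)$ a block of rows. For a positive integer $i$ let $k_i=i(t-1)+1$, and suppose $k_i\le k$. Then the restriction of $\mathcal{M}$ to any $k_i$ blocks of rows is the incidence matrix of an $i$-CFF$(k_iv,n)$.
   Context: A packing array PA$(n;t,k,v)$ is an $n\times k$ array with entries from an alphabet of $v$ symbols such that in any $t$ columns every $t$-tuple of symbols occurs in at most one row. An SHF$(N;n,m,\{1,w\})$ is an $N\times n$ array over $m$ symbols such that for every column $c_0$ and every set $C$ of $w$ other columns some row $r$ has $A(r,c_0)\ne A(r,c)$ for all $c\in C$. A $d$-CFF$(t,n)$ is a set system with $t$ points and $n$ blocks in which no block is contained in the union of any $d$ other blocks, represented by its $t\times n$ binary incidence matrix. -}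

module Defs where

open import Data.Nat using (ℕ; suc; _+_; _*_; _∸_)
open import Data.Fin using (Fin; _≟_; remQuot)
open import Data.Bool using (Bool; true; false)
open import Data.Product using (Σ; _×_; _,_)
open import Relation.Binary.PropositionalEquality using (_≡_; _≢_)
open import Relation.Nullary using (does)
open import Function.Definitions using (Injective)

-- An array with r rows and c columns over symbols Fin s (symbol x ∈ Fin s
-- stands for x+1 ∈ {1,…,s}).
Array : ℕ → ℕ → ℕ → Set
Array r c s = Fin r → Fin c → Fin s

-- Packing array PA(n;t,k,v): an n × k array over v symbols such that for any
-- t distinct columns (an injective choice cols : Fin t → Fin k), every
-- t-tuple of symbols occurs in at most one row: two rows agreeing on all the
-- chosen columns are the same row.
IsPA : (n t k v : ℕ) → Array n k v → Set
IsPA n t k v P =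
  (cols : Fin t → Fin k) → Injective _≡_ _≡_ cols →
  (r₁ r₂ : Fin n) → ((l : Fin t) → P r₁ (cols l) ≡ P r₂ (cols l)) → r₁ ≡ r₂

transpose : ∀ {r c s} → Array r c s → Array c r s
transpose P i j = P j i

-- d-CFF(T,n): a T × n binary incidence matrix (rows = points, columns =
-- blocks; entry true = incidence) such that no block is contained in the
-- union of any d other blocks: for every block j₀ and every d distinct
-- blocks C different from j₀ there is a point in j₀ lying in none of C.
IsCFF : (d T n : ℕ) → (Fin T → Fin n → Bool) → Set
IsCFF d T n M =
  (j₀ : Fin n) (C : Fin d → Fin n) → Injective _≡_ _≡_ C →
  ((l : Fin d) → C l ≢ j₀) →
  Σ (Fin T) λ p → (M p j₀ ≡ true) × ((l : Fin d) → M p (C l) ≡ false)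

𝓜 : ∀ {k n v} → Array k n v → Fin k × Fin v → Fin n → Bool
𝓜 A (i , x) j = does (A i j ≟ x)

restrict : ∀ {k n v} (m : ℕ) → Array k n v → (Fin m → Fin k) →
           Fin (m * v) → Fin n → Bool
restrict {v = v} m A S p j with remQuot {m} v p
... | (a , x) = 𝓜 A (S a , x) j

kᵢ : ℕ → ℕ → ℕ
kᵢ t i = i * (t ∸ 1) + 1

-- Two distinct rows of a packing array of strength t agree in at most t − 1
-- columns. Hence, for each of the i columns C l of A = Pᵀ, at most t − 1 of the
-- chosen blocks S a have A (S a) (C l) = A (S a) j₀. These bad blocks number at
-- most i(t − 1) < kᵢ, so some chosen block S a is good for every l, and the row
-- (S a , A (S a) j₀) of 𝓜 lies in column j₀ but in none of the columns C l.
module Submission where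

open import Defs
open import Data.Nat using (ℕ; zero; suc; _≤_; _<_; _+_; _*_; _∸_; z≤n; s≤s)
open import Data.Nat.Properties
  using (≤-trans; ≤-reflexive; ≤-pred; +-suc; +-mono-≤; +-monoʳ-≤; n≤1+n; ≤-<-trans; m<m+n; ≰⇒>;
         _≤?_)
open import Data.Fin using (Fin; zero; suc; combine) renaming (_≟_ to _≟ᶠ_)
open import Data.Fin.Properties using (suc-injective; remQuot-combine)
open import Data.Bool using (Bool; true; false; _∨_; if_then_else_)
open import Data.Product using (Σ; _×_; _,_; proj₁; proj₂)
open import Data.Empty using (⊥-elim)
open import Function using (_∘_)
open import Function.Definitions using (Injective)
open import Relation.Nullary using (does; yes; no)
open import Relation.Nullary.Decidable using (dec-true)
open import Relation.Unary using (Pred; Decidable)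
open import Relation.Binary.PropositionalEquality using (_≡_; _≢_; refl; cong; sym; trans)

count : ∀ {m} → (Fin m → Bool) → ℕ
count {zero}  f = 0
count {suc m} f = if f zero then suc (count (f ∘ suc)) else count (f ∘ suc)

count-∨ : ∀ {m} (f g : Fin m → Bool) → count (λ a → f a ∨ g a) ≤ count f + count g
count-∨ {zero}  f g = z≤n
count-∨ {suc m} f g with f zero | g zero | count-∨ (f ∘ suc) (g ∘ suc)
... | true  | true  | r = s≤s (≤-trans r (+-monoʳ-≤ (count (f ∘ suc)) (n≤1+n _)))
... | true  | false | r = s≤s r
... | false | true  | r = ≤-trans (s≤s r) (≤-reflexive (sym (+-suc _ _)))
... | false | false | r = r

⋁ : ∀ {i} → (Fin i → Bool) → Bool
⋁ {zero}  b = false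
⋁ {suc i} b = b zero ∨ ⋁ (b ∘ suc)

⋁≡false : ∀ {i} (b : Fin i → Bool) → ⋁ b ≡ false → (l : Fin i) → b l ≡ false
⋁≡false {suc i} b eq l with b zero in b₀
⋁≡false b eq zero    | false = b₀
⋁≡false b eq (suc l) | false = ⋁≡false (b ∘ suc) eq l

count-⋁ : ∀ {i m} c (B : Fin i → Fin m → Bool) → ((l : Fin i) → count (B l) ≤ c) →
          count (λ a → ⋁ λ l → B l a) ≤ i * c
count-⋁ {zero}  {zero}  c B _ = z≤n
count-⋁ {zero}  {suc m} c B _ = count-⋁ {zero} {m} c (λ l → B l ∘ suc) λ ()
count-⋁ {suc i}         c B bound =
  ≤-trans (count-∨ (B zero) (λ a → ⋁ λ l → B (suc l) a))
          (+-mono-≤ (bound zero) (count-⋁ c (B ∘ suc) (bound ∘ suc)))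

count<⇒∃false : ∀ {m} (f : Fin m → Bool) → count f < m → Σ (Fin m) λ a → f a ≡ false
count<⇒∃false {suc m} f lt with f zero in f₀
... | false = zero , f₀
... | true  with a , fa ← count<⇒∃false (f ∘ suc) (≤-pred lt) = suc a , fa

≤count⇒injection : ∀ {p m} {Q : Pred (Fin m) p} (Q? : Decidable Q) t →
                   t ≤ count (does ∘ Q?) →
                   Σ (Fin t → Fin m) λ g → Injective _≡_ _≡_ g × ((x : Fin t) → Q (g x))
≤count⇒injection             Q? zero    _ = (λ ()) , (λ { {()} }) , λ ()
≤count⇒injection {m = suc m} {Q} Q? (suc t) le with Q? zero
... | no _ with g , g-inj , Qg ← ≤count⇒injection (Q? ∘ suc) (suc t) le =
  suc ∘ g , g-inj ∘ suc-injective , Qg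
... | yes Q₀ with g , g-inj , Qg ← ≤count⇒injection (Q? ∘ suc) t (≤-pred le) =
  h , h-inj , Qh
  where
  h : Fin (suc t) → Fin (suc m)
  h zero    = zero
  h (suc x) = suc (g x)
  h-inj : Injective _≡_ _≡_ h
  h-inj {zero}  {zero}  _ = refl
  h-inj {suc x} {suc y} e = cong suc (g-inj (suc-injective e))
  Qh : (x : Fin (suc t)) → Q (h x)
  Qh zero    = Q₀
  Qh (suc x) = Qg x

agree : ∀ {n k v} → Array n k v → Fin n → Fin n → Fin k → Bool
agree P r₁ r₂ c = does (P r₁ c ≟ᶠ P r₂ c)

IsPA⇒count-agree≤ : ∀ {n s k v m} (P : Array n k v) → IsPA n (suc s) k v P →
                    (S : Fin m → Fin k) → Injective _≡_ _≡_ S →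
                    ∀ {r₁ r₂} → r₁ ≢ r₂ → count (agree P r₁ r₂ ∘ S) ≤ s
IsPA⇒count-agree≤ {s = s} P pa S S-inj {r₁} {r₂} r₁≢r₂ with count (agree P r₁ r₂ ∘ S) ≤? s
... | yes le = le
... | no  gt
  with g , g-inj , agree-g ← ≤count⇒injection (λ a → P r₁ (S a) ≟ᶠ P r₂ (S a)) (suc s) (≰⇒> gt) =
  ⊥-elim (r₁≢r₂ (pa (S ∘ g) (g-inj ∘ S-inj) r₁ r₂ agree-g))

restrict-combine : ∀ {k n v} m (A : Array k n v) (S : Fin m → Fin k) a x j →
                   restrict m A S (combine a x) j ≡ 𝓜 A (S a , x) j
restrict-combine m A S a x j = cong (λ (b , y) → 𝓜 A (S b , y) j) (remQuot-combine a x)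

proposition3 : (n t k v : ℕ) → 2 ≤ t →
    (P : Array n k v) → IsPA n t k v P →
    (w : ℕ) → 1 ≤ w → w * (t ∸ 1) ≤ k ∸ 1 →
    (i : ℕ) → 1 ≤ i → kᵢ t i ≤ k →
    (S : Fin (kᵢ t i) → Fin k) → Injective _≡_ _≡_ S →
    IsCFF i (kᵢ t i * v) n (restrict (kᵢ t i) (transpose P) S)
proposition3 n (suc t) k v _ P pa _ _ _ i _ _ S S-inj j₀ C _ C≢j₀ =
  combine a (P j₀ (S a)) , in-j₀ , out-C
  where
  meets : Fin i → Fin (kᵢ (suc t) i) → Bool
  meets l = agree P (C l) j₀ ∘ S
  few-meetings : count (λ a → ⋁ λ l → meets l a) < i * t + 1
  few-meetings = ≤-<-trans (count-⋁ t meets λ l → IsPA⇒count-agree≤ P pa S S-inj (C≢j₀ l))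
                           (m<m+n (i * t) (s≤s z≤n))
  avoider : Σ (Fin (kᵢ (suc t) i)) λ a → (⋁ λ l → meets l a) ≡ false
  avoider = count<⇒∃false _ few-meetings
  a : Fin (kᵢ (suc t) i)
  a = proj₁ avoider
  in-j₀ : restrict _ (transpose P) S (combine a (P j₀ (S a))) j₀ ≡ true
  in-j₀ = trans (restrict-combine _ (transpose P) S a _ j₀)
                (dec-true (P j₀ (S a) ≟ᶠ P j₀ (S a)) refl)
  out-C : (l : Fin i) → restrict _ (transpose P) S (combine a (P j₀ (S a))) (C l) ≡ false
  out-C l = trans (restrict-combine _ (transpose P) S a _ (C l))
                  (⋁≡false _ (proj₂ avoider) l)
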